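{- Let $Q$ be a square-free word of length $n\geq 2$. For every position $i\in\{1,\dots,n\}$, the number of almost-squares that are factors of $Q$ starting at the $i$-th letter of $Q$ (equivalently, the number of lengths $L$ such that the factor of $Q$ of length $L$ beginning at position $i$ is an almost-square) is less than $$2\log_{5/4} n.$$
   Context: A word is a finite sequence of letters. A factor of a word is a contiguous subword. A square is a nonempty word of the form $YY$; a word is square-free if none of its factors is a square. An extension of a word $W$ over an alphabet $\mathbb{A}$ is any word $W_1xW_2$ with $W=W_1W_2$ ($W_1,W_2$ possibly empty) and $x\in\mathbb{A}$. An almost-square is a word of the form $WW'$ where $W'$ is either an extension of $W$ or is obtained from $W$ by deleting one letter. -}

module Defs where

open import Data.Nat using (ℕ)
open import Data.List using (List; []; _∷_; _++_; take; drop; length)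
open import Data.Product using (Σ; _×_; ∃)
open import Data.Sum using (_⊎_)
open import Relation.Binary.PropositionalEquality using (_≡_; _≢_)

SquareFree : {A : Set} → List A → Set
SquareFree {A} w = (u Y v : List A) → Y ≢ [] → w ≢ u ++ (Y ++ (Y ++ v))

Extension : {A : Set} → List A → List A → Set
Extension {A} W W' =
  Σ (List A) λ W₁ → Σ (List A) λ W₂ → Σ A λ x →
    (W ≡ W₁ ++ W₂) × (W' ≡ W₁ ++ (x ∷ W₂))

DeletesOne : {A : Set} → List A → List A → Set
DeletesOne W W' = Extension W' W

AlmostSquare : {A : Set} → List A → Set
AlmostSquare {A} u =
  Σ (List A) λ W → Σ (List A) λ W' →
    (u ≡ W ++ W') × (Extension W W' ⊎ DeletesOne W W')

-- The factor of Q of length L starting at 0-based position i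
-- (only meaningful when i + L ≤ length Q).
factorAt : {A : Set} → List A → ℕ → ℕ → List A
factorAt Q i L = take L (drop i Q)

module Submission where

-- Write an almost-square prefix of length 2h+1 as W W′. Every letter of the second half repeats
-- the letter h positions earlier up to a switch point τ and the letter h+1 positions earlier after
-- it (or the other way round), with at most one exceptional position at τ. Take two such prefixes
-- with half-lengths c and e = c+1+d, d ≥ 1. On any stretch of positions where both offsets are
-- constant, they differ by some s ∈ [d, d+2], and a window of s positions inside the stretch
-- would produce a square; so the stretch is shorter than s. Between its start and 2c+1 the longer
-- prefix's second half is cut by the two switch points into at most three such stretches, which
-- gives c ≤ 4d + 3, i.e. 5c < 4e, and so 5L < 4L′ for the lengths L = 2c+1 < L′ = 2e+1 once
-- L′ ≥ L + 4. The lengths of almost-squares starting at one position are odd, so in sorted order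
-- every second one is larger by a factor greater than 5/4, and k of them force 5ᵏ < 4ᵏn².

open import Defs
open import Data.Empty using (⊥; ⊥-elim)
open import Data.Maybe using (Maybe; just; nothing)
open import Data.Nat
open import Data.Nat.Properties
open import Data.Nat.Tactic.RingSolver using (solve; solve-∀)
open import Data.List using (List; []; _∷_; [_]; _++_; take; drop; length)
open import Data.List.Properties
  using (++-assoc; ++-identityʳ; length-++; length-take; length-drop; take++drop≡id)
open import Data.List.Relation.Unary.All using (All)
open import Data.List.Relation.Unary.Linked using (Linked)
open import Data.List.Relation.Unary.Unique.Propositional using (Unique)
open import Data.Product using (∃-syntax; _×_; _,_; uncurry)
open import Data.Sum using (_⊎_; inj₁; inj₂; [_,_]′)
open import Data.List.Relation.Binary.Permutation.Propositional using (↭-sym; ↭⇒↭ₛ)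
open import Data.List.Relation.Binary.Permutation.Propositional.Properties using (All-resp-↭; ↭-length)
open import Data.List.Sort ≤-decTotalOrder using (sort; sort-↭; sort-↗)
open import Relation.Binary.PropositionalEquality hiding ([_])
open import Data.List.Relation.Binary.Permutation.Setoid.Properties (setoid ℕ) using (Unique-resp-↭)
open import Function.Base using (_$_)
open import Relation.Nullary using (yes; no)

module _ {A : Set} where

  infixl 9 _‼_

  -- Positions past the end read as nothing, so letter equalities carry information only
  -- together with a bound on the positions.
  _‼_ : List A → ℕ → Maybe A
  []       ‼ _     = nothing
  (x ∷ xs) ‼ zero  = just x
  (x ∷ xs) ‼ suc p = xs ‼ p

  ‼-++ˡ : ∀ (xs ys : List A) {p} → p < length xs → (xs ++ ys) ‼ p ≡ xs ‼ p
  ‼-++ˡ (x ∷ xs) ys {zero}  _         = refl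
  ‼-++ˡ (x ∷ xs) ys {suc p} (s≤s p<n) = ‼-++ˡ xs ys p<n

  ‼-++ʳ : ∀ (xs ys : List A) p → (xs ++ ys) ‼ (length xs + p) ≡ ys ‼ p
  ‼-++ʳ []       ys p = refl
  ‼-++ʳ (x ∷ xs) ys p = ‼-++ʳ xs ys p

  ‼-take : ∀ n (xs : List A) {p} → p < n → take n xs ‼ p ≡ xs ‼ p
  ‼-take (suc n) []       _         = refl
  ‼-take (suc n) (x ∷ xs) {zero}  _         = refl
  ‼-take (suc n) (x ∷ xs) {suc p} (s≤s p<n) = ‼-take n xs p<n

  ‼-drop : ∀ n (xs : List A) p → drop n xs ‼ p ≡ xs ‼ (n + p)
  ‼-drop zero    xs       p = refl
  ‼-drop (suc n) []       p = refl
  ‼-drop (suc n) (x ∷ xs) p = ‼-drop n xs p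

  ‼-ext : ∀ (xs ys : List A) → length xs ≡ length ys →
          (∀ {p} → p < length xs → xs ‼ p ≡ ys ‼ p) → xs ≡ ys
  ‼-ext []       []       _   _  = refl
  ‼-ext (x ∷ xs) (y ∷ ys) len eq with refl ← eq {zero} z<s =
    cong (x ∷_) (‼-ext xs ys (suc-injective len) (λ p<n → eq (s≤s p<n)))

  length-take-≤ : ∀ n (xs : List A) → n ≤ length xs → length (take n xs) ≡ n
  length-take-≤ n xs n≤ = trans (length-take n xs) (m≤n⇒m⊓n≡m n≤)

  ≤-length-drop : ∀ n (xs : List A) {m} → n + m ≤ length xs → m ≤ length (drop n xs)
  ≤-length-drop n xs {m} n+m≤ =
    subst (m ≤_) (sym (length-drop n xs)) (m+n≤o⇒m≤o∸n m (subst (_≤ length xs) (+-comm n m) n+m≤))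

  SquareFree-drop : ∀ n (w : List A) → SquareFree w → SquareFree (drop n w)
  SquareFree-drop n w sf u Y v Y≢[] eq = sf (take n w ++ u) Y v Y≢[] (begin
    w                                   ≡⟨ take++drop≡id n w ⟨
    take n w ++ drop n w                ≡⟨ cong (take n w ++_) eq ⟩
    take n w ++ (u ++ (Y ++ (Y ++ v)))  ≡⟨ ++-assoc (take n w) u _ ⟨
    (take n w ++ u) ++ (Y ++ (Y ++ v))  ∎)
    where open ≡-Reasoning

  no-square-prefix : ∀ {w : List A} {s} → SquareFree w → 0 < s → s + s ≤ length w →
                      (∀ {k} → k < s → w ‼ k ≡ w ‼ (s + k)) → ⊥
  no-square-prefix {w} {s} sf 0<s s+s≤ halves-agree = sf [] Y V Y≢[] (begin
    w              ≡⟨ take++drop≡id s w ⟨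
    Y ++ drop s w  ≡⟨ cong (Y ++_) (take++drop≡id s (drop s w)) ⟨
    Y ++ (Y′ ++ V) ≡⟨ cong (λ Z → Y ++ (Z ++ V)) Y′≡Y ⟩
    Y ++ (Y ++ V)  ∎)
    where
    open ≡-Reasoning
    Y = take s w
    Y′ = take s (drop s w)
    V = drop s (drop s w)
    |Y| : length Y ≡ s
    |Y| = length-take-≤ s w (m+n≤o⇒m≤o s s+s≤)
    |Y′| : length Y′ ≡ s
    |Y′| = length-take-≤ s (drop s w) (≤-length-drop s w s+s≤)
    Y≢[] : Y ≢ []
    Y≢[] Y≡[] = <⇒≢ 0<s (trans (sym (cong length Y≡[])) |Y|)
    Y′≡Y : Y′ ≡ Y
    Y′≡Y = ‼-ext Y′ Y (trans |Y′| (sym |Y|)) λ {k} k<|Y′| →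
      let k<s = subst (k <_) |Y′| k<|Y′| in begin
        Y′ ‼ k           ≡⟨ ‼-take s (drop s w) k<s ⟩
        drop s w ‼ k     ≡⟨ ‼-drop s w k ⟩
        w ‼ (s + k)      ≡⟨ halves-agree k<s ⟨
        w ‼ k            ≡⟨ ‼-take s w k<s ⟨
        Y ‼ k            ∎

  no-square-at : ∀ {w : List A} b {s} → SquareFree w → 0 < s → b + s + s ≤ length w →
                  (∀ {k} → k < s → w ‼ (b + k) ≡ w ‼ (b + s + k)) → ⊥
  no-square-at {w} b {s} sf 0<s b+s+s≤ halves-agree =
    no-square-prefix (SquareFree-drop b w sf) 0<s
      (≤-length-drop b w (subst (_≤ length w) (+-assoc b s s) b+s+s≤))
      λ {k} k<s → begin
        drop b w ‼ k        ≡⟨ ‼-drop b w k ⟩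
        w ‼ (b + k)         ≡⟨ halves-agree k<s ⟩
        w ‼ (b + s + k)     ≡⟨ cong (w ‼_) (+-assoc b s k) ⟩
        w ‼ (b + (s + k))   ≡⟨ ‼-drop b w (s + k) ⟨
        drop b w ‼ (s + k)  ∎
    where open ≡-Reasoning

WindowFree : ℕ → ℕ → ℕ → Set
WindowFree s l h = ∀ {a} → l ≤ a → a + s ≤ h → ⊥

private
  reassociate : ∀ l s g S → l + s + g + S ≡ l + (s + g + S)
  reassociate = solve-∀

WindowFree⇒short : ∀ {s l h} → WindowFree s l h → h < l + s
WindowFree⇒short {s} {l} {h} free with l + s ≤? h
... | yes l+s≤h = ⊥-elim (free ≤-refl l+s≤h)
... | no  l+s≰h = ≰⇒> l+s≰h

two-pieces : ∀ {s l x g h k S} → 0 < s → k ≤ S → WindowFree s l (x ⊓ h) →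
             h + k ≤ (l ⊔ (x + g)) + S → h + suc k ≤ l + (s + g + S)
two-pieces {s} {l} {x} {g} {h} {k} {S} 0<s k≤S free rest with ≤-total x h
... | inj₂ h≤x = begin
  h + suc k        ≡⟨ +-suc h k ⟩
  suc h + k        ≤⟨ +-mono-≤ (subst (_< l + s) (m≥n⇒m⊓n≡n h≤x) (WindowFree⇒short free)) k≤S ⟩
  l + s + S        ≤⟨ +-monoˡ-≤ S (m≤m+n (l + s) g) ⟩
  l + s + g + S    ≡⟨ reassociate l s g S ⟩
  l + (s + g + S)  ∎
  where open ≤-Reasoning
... | inj₁ x≤h with ≤-total (x + g) l
...   | inj₁ x+g≤l = begin
  h + suc k        ≡⟨ +-suc h k ⟩
  suc (h + k)      ≤⟨ s≤s (subst (λ m → h + k ≤ m + S) (m≥n⇒m⊔n≡m x+g≤l) rest) ⟩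
  suc l + S        ≡⟨ cong (_+ S) (+-comm 1 l) ⟩
  l + 1 + S        ≤⟨ +-monoˡ-≤ S (+-monoʳ-≤ l 0<s) ⟩
  l + s + S        ≤⟨ +-monoˡ-≤ S (m≤m+n (l + s) g) ⟩
  l + s + g + S    ≡⟨ reassociate l s g S ⟩
  l + (s + g + S)  ∎
  where open ≤-Reasoning
...   | inj₂ l≤x+g = begin
  h + suc k        ≡⟨ +-suc h k ⟩
  suc (h + k)      ≤⟨ s≤s (subst (λ m → h + k ≤ m + S) (m≤n⇒m⊔n≡n l≤x+g) rest) ⟩
  suc x + g + S    ≤⟨ +-monoˡ-≤ S (+-monoˡ-≤ g
                        (subst (_< l + s) (m≤n⇒m⊓n≡m x≤h) (WindowFree⇒short free))) ⟩
  l + s + g + S    ≡⟨ reassociate l s g S ⟩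
  l + (s + g + S)  ∎
  where open ≤-Reasoning

three-pieces : ∀ {s₁ s₂ s₃ l x g₁ y g₂ h} → 0 < s₁ → 0 < s₂ → 0 < s₃ →
  WindowFree s₁ l (x ⊓ h) → WindowFree s₂ (l ⊔ (x + g₁)) (y ⊓ h) →
  WindowFree s₃ (l ⊔ (x + g₁) ⊔ (y + g₂)) h → h + 3 ≤ l + (s₁ + g₁ + (s₂ + g₂ + s₃))
three-pieces {s₁} {s₂} {s₃} {l} {x} {g₁} {y} {g₂} {h} 0<s₁ 0<s₂ 0<s₃ free₁ free₂ free₃ =
  two-pieces 0<s₁ (+-mono-≤ (≤-trans 0<s₂ (m≤m+n s₂ g₂)) 0<s₃) free₁
    (two-pieces 0<s₂ 0<s₃ free₂
       (subst (_≤ l ⊔ (x + g₁) ⊔ (y + g₂) + s₃) (+-comm 1 h) (WindowFree⇒short free₃)))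

switch-order : ∀ x g y g′ → g ≤ 1 → g′ ≤ 1 → x + g ≤ y ⊎ y + g′ ≤ x ⊎ (x ≤ y × y ≤ x)
switch-order x g y g′ g≤1 g′≤1 with x + g ≤? y | y + g′ ≤? x
... | yes x+g≤y | _          = inj₁ x+g≤y
... | no _      | yes y+g′≤x = inj₂ (inj₁ y+g′≤x)
... | no x+g≰y  | no y+g′≰x  =
  inj₂ (inj₂ (≤-before-gap g′≤1 y+g′≰x , ≤-before-gap g≤1 x+g≰y))
  where
  ≤-before-gap : ∀ {x y g} → g ≤ 1 → y + g ≰ x → x ≤ y
  ≤-before-gap {x} {y} g≤1 y+g≰x =
    m<1+n⇒m≤n (≤-trans (≰⇒> y+g≰x) (≤-trans (+-monoʳ-≤ y g≤1) (≤-reflexive (+-comm y 1))))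

spread⇒ratio : ∀ c d → c ≤ 3 + 4 * d → 5 * c < 4 * (suc c + d)
spread⇒ratio c d c≤3+4d = begin
  suc (5 * c)        ≡⟨ solve (c ∷ []) ⟩
  suc c + 4 * c      ≤⟨ +-monoˡ-≤ (4 * c) (s≤s c≤3+4d) ⟩
  4 + 4 * d + 4 * c  ≡⟨ solve (c ∷ d ∷ []) ⟩
  4 * (suc c + d)    ∎
  where open ≤-Reasoning

cancel-≤ : ∀ {L R} l r k → L ≤ R → L ≡ l + k → R ≡ r + k → l ≤ r
cancel-≤ l r k L≤R refl refl = +-cancelʳ-≤ k l r L≤R

m+m≤n+n⇒m≤n : ∀ {m n} → m + m ≤ n + n → m ≤ n
m+m≤n+n⇒m≤n {m} {n} m+m≤n+n with m ≤? n
... | yes m≤n = m≤n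
... | no  m≰n = ⊥-elim (<⇒≱ (+-mono-< (≰⇒> m≰n) (≰⇒> m≰n)) m+m≤n+n)

ratio⇒odd-ratio : ∀ {c e} → 5 * c < 4 * e → 5 * suc (c + c) < 4 * suc (e + e)
ratio⇒odd-ratio {c} {e} 5c<4e = cancel-≤ (suc (5 * suc (c + c))) (4 * suc (e + e)) 0
  (+-mono-≤ (+-mono-≤ 5c<4e 5c<4e) (≤-refl {4}))
  (solve (c ∷ [])) (solve (e ∷ []))

-- The window bounds of the three cases of the core argument below, turned into c ≤ 4d + 3; gL and
-- gS are the gaps of the longer and the shorter almost-square, gL′ and gS′ their complements.
-- Each conclusion is a nonnegative combination of the hypothesis with the gap constraints.
module _ {gL gL′ gS gS′ : ℕ} (gL+gL′≡1 : gL + gL′ ≡ 1) (gS+gS′≡1 : gS + gS′ ≡ 1) where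

  private
    infixl 6 _⊕_
    _⊕_ : ∀ {a b c d} → a ≤ b → c ≤ d → a + c ≤ b + d
    _⊕_ = +-mono-≤
    L≤1 = ≤-reflexive gL+gL′≡1
    S≤1 = ≤-reflexive gS+gS′≡1
    gL≤1 = subst (gL ≤_) gL+gL′≡1 (m≤m+n gL gL′)
    gL′≤1 = subst (gL′ ≤_) gL+gL′≡1 (m≤n+m gL′ gL)
    gS≤1 = subst (gS ≤_) gS+gS′≡1 (m≤m+n gS gS′)

  switch-bound₁ : ∀ {c d} →
    suc (c + c) + 3 ≤ suc c + d + gL′ + (d + gL′ + gS + gL + (d + gL + gS + gS + (d + gL + gS′))) →
    c ≤ 3 + 4 * d
  switch-bound₁ {c} {d} H = cancel-≤ c (3 + 4 * d) (c + 4 + 3 * gL + 2 * gL′ + 3 * gS + gS′)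
    (H ⊕ L≤1 ⊕ L≤1 ⊕ S≤1 ⊕ gL≤1 ⊕ gS≤1 ⊕ gS≤1)
    (solve (c ∷ d ∷ gL ∷ gL′ ∷ gS ∷ gS′ ∷ []))
    (solve (c ∷ d ∷ gL ∷ gL′ ∷ gS ∷ gS′ ∷ []))

  switch-bound₂ : ∀ {c d} →
    suc (c + c) + 3 ≤ suc c + d + gL′ + (d + gL′ + gS + gS + (d + gL′ + gS′ + gL + (d + gL + gS′))) →
    c ≤ 3 + 4 * d
  switch-bound₂ {c} {d} H = ≤-trans
    (cancel-≤ c (2 + 4 * d) (c + 4 + 2 * gL + 3 * gL′ + 2 * gS + 2 * gS′)
    (H ⊕ L≤1 ⊕ L≤1 ⊕ S≤1 ⊕ S≤1 ⊕ gL′≤1)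
    (solve (c ∷ d ∷ gL ∷ gL′ ∷ gS ∷ gS′ ∷ []))
    (solve (c ∷ d ∷ gL ∷ gL′ ∷ gS ∷ gS′ ∷ [])))
    (n≤1+n (2 + 4 * d))

  switch-bound₃ : ∀ {c d} →
    suc (c + c) + 2 ≤ suc c + d + gL′ + (d + gL′ + gS + 1 + (d + gL + gS′)) →
    c ≤ 3 + 4 * d
  switch-bound₃ {c} {d} H = ≤-trans (cancel-≤ c (2 + 3 * d) (c + 3 + gL + 2 * gL′ + gS + gS′)
    (H ⊕ L≤1 ⊕ S≤1 ⊕ gL′≤1)
    (solve (c ∷ d ∷ gL ∷ gL′ ∷ gS ∷ gS′ ∷ []))
    (solve (c ∷ d ∷ gL ∷ gL′ ∷ gS ∷ gS′ ∷ [])))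
    (+-mono-≤ (n≤1+n 2) (*-monoˡ-≤ d (n≤1+n 3)))

module _ {A : Set} where

  -- A record rather than a function type, so that w and o can be inferred from it.
  record PeriodicOn (w : List A) (o l h : ℕ) : Set where
    field
      repeats : ∀ {p} → l ≤ p + o → p + o < h → w ‼ p ≡ w ‼ (p + o)

  open PeriodicOn

  PeriodicOn-⊆ : ∀ {w o l h l′ h′} → l ≤ l′ → h′ ≤ h → PeriodicOn w o l h → PeriodicOn w o l′ h′
  PeriodicOn-⊆ l≤l′ h′≤h per .repeats l′≤q q<h′ =
    repeats per (≤-trans l≤l′ l′≤q) (<-≤-trans q<h′ h′≤h)

  -- The letters of a window [a, a + s) in which both periods hold repeat the s letters at a - o - s
  -- as well as the s letters at a - o: a square.
  PeriodicOn⇒WindowFree : ∀ {w : List A} {o o′ s l h} → SquareFree w → 0 < s → o + s ≡ o′ →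
    o′ ≤ l → h ≤ length w → PeriodicOn w o′ l h → PeriodicOn w o l h → WindowFree s l h
  PeriodicOn⇒WindowFree {w} {o} {_} {s} {l} {h} sf 0<s refl o′≤l h≤|w| per′ per {a} l≤a a+s≤h =
    no-square-at b sf 0<s b+s+s≤|w| halves-agree
    where
    b = a ∸ (o + s)
    b+o+s≡a : b + (o + s) ≡ a
    b+o+s≡a = m∸n+n≡m (≤-trans o′≤l l≤a)
    b+s+s≤|w| : b + s + s ≤ length w
    b+s+s≤|w| = begin
      b + s + s        ≤⟨ +-monoˡ-≤ s (+-monoʳ-≤ b (m≤n+m s o)) ⟩
      b + (o + s) + s  ≡⟨ cong (_+ s) b+o+s≡a ⟩
      a + s            ≤⟨ a+s≤h ⟩
      h                ≤⟨ h≤|w| ⟩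
      length w         ∎
      where open ≤-Reasoning
    shift₁ : ∀ b k o s → b + k + (o + s) ≡ b + (o + s) + k
    shift₁ = solve-∀
    shift₂ : ∀ b k o s → b + s + k + o ≡ b + (o + s) + k
    shift₂ = solve-∀
    halves-agree : ∀ {k} → k < s → w ‼ (b + k) ≡ w ‼ (b + s + k)
    halves-agree {k} k<s = trans (via-a+k (b + k) (trans (shift₁ b k o s) a+k≡) per′)
                       (sym (via-a+k (b + s + k) (trans (shift₂ b k o s) a+k≡) per))
      where
      a+k≡ : b + (o + s) + k ≡ a + k
      a+k≡ = cong (_+ k) b+o+s≡a
      via-a+k : ∀ p {o″} → p + o″ ≡ a + k → PeriodicOn w o″ l h → w ‼ p ≡ w ‼ (a + k)
      via-a+k p eq per″ = trans (repeats per″ (subst (l ≤_) (sym eq) (≤-trans l≤a (m≤m+n a k)))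
                                       (subst (_< h) (sym eq) (<-≤-trans (+-monoʳ-< a k<s) a+s≤h)))
                                (cong (w ‼_) eq)

  repeated-segment : ∀ {w : List A} X S Z X′ Z′ {o l h} → w ≡ X ++ S ++ Z → w ≡ X′ ++ S ++ Z′ →
    length X′ ≡ length X + o → length X′ ≡ l → length X′ + length S ≡ h → PeriodicOn w o l h
  repeated-segment X S Z X′ Z′ {o} refl w≡ |X′|≡ refl refl .repeats {p} l≤p+o p+o<h = begin
    w ‼ p                       ≡⟨ cong (w ‼_) p≡ ⟩
    w ‼ (length X + r)          ≡⟨ ‼-++ʳ X (S ++ Z) r ⟩
    (S ++ Z) ‼ r                ≡⟨ ‼-++ˡ S Z r<|S| ⟩
    S ‼ r                       ≡⟨ ‼-++ˡ S Z′ r<|S| ⟨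
    (S ++ Z′) ‼ r               ≡⟨ ‼-++ʳ X′ (S ++ Z′) r ⟨
    (X′ ++ S ++ Z′) ‼ (length X′ + r) ≡⟨ cong (_‼ (length X′ + r)) w≡ ⟨
    w ‼ (length X′ + r)         ≡⟨ cong (w ‼_) p+o≡ ⟩
    w ‼ (p + o)                 ∎
    where
    open ≡-Reasoning
    w = X ++ S ++ Z
    r = p + o ∸ length X′
    p+o≡ : length X′ + r ≡ p + o
    p+o≡ = m+[n∸m]≡n l≤p+o
    r<|S| : r < length S
    r<|S| = +-cancelˡ-< (length X′) r (length S)
              (subst (_< length X′ + length S) (sym p+o≡) p+o<h)
    p≡ : p ≡ length X + r
    p≡ = +-cancelʳ-≡ o p (length X + r) (begin
      p + o                  ≡⟨ p+o≡ ⟨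
      length X′ + r          ≡⟨ cong (_+ r) |X′|≡ ⟩
      length X + o + r       ≡⟨ +-assoc (length X) o r ⟩
      length X + (o + r)     ≡⟨ cong (length X +_) (+-comm o r) ⟩
      length X + (r + o)     ≡⟨ +-assoc (length X) r o ⟨
      length X + r + o       ∎)

  -- For W W′ with W′ = W₁ x W₂ an extension of W = W₁ W₂ (so h = |W|), the second half repeats
  -- with offset h on [h, τ) where τ = h + |W₁|, the inserted x sits at τ (gap = 1), and the rest
  -- repeats with offset h + 1. For a deletion the offsets are h + 1 and then h, with no gap.
  record SplitPeriodic (w : List A) (h : ℕ) : Set where
    field
      gap gap′ τ : ℕ
      gap+gap′≡1 : gap + gap′ ≡ 1
      h≤τ : h ≤ τ
      τ≤2h+1 : τ ≤ suc (h + h)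
      before : PeriodicOn w (h + gap′) (h + gap′) τ
      after  : PeriodicOn w (h + gap) (τ + gap) (suc (h + h))

    gap≤1 : gap ≤ 1
    gap≤1 = subst (gap ≤_) gap+gap′≡1 (m≤m+n gap gap′)

    gap′≤1 : gap′ ≤ 1
    gap′≤1 = subst (gap′ ≤_) gap+gap′≡1 (m≤n+m gap′ gap)

    gap′+gap≡1 : gap′ + gap ≡ 1
    gap′+gap≡1 = trans (+-comm gap′ gap) gap+gap′≡1

  ++-split-last : ∀ (P Q R : List A) → P ++ (Q ++ R) ≡ (P ++ Q) ++ R ++ []
  ++-split-last P Q R = trans (sym (++-assoc P Q R)) (cong ((P ++ Q) ++_) (sym (++-identityʳ R)))

  extension⇒SplitPeriodic : ∀ (W₁ W₂ : List A) x →
    let u = (W₁ ++ W₂) ++ W₁ ++ x ∷ W₂ ; h = length W₁ + length W₂ in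
    length u ≡ suc (h + h) × SplitPeriodic u h
  extension⇒SplitPeriodic W₁ W₂ x =
    trans (trans (length-++ (W₁ ++ W₂)) (cong₂ _+_ |W₁W₂| |W₁xW₂|)) (length≡ j m) , record
      { gap = 1 ; gap′ = 0 ; τ = j + m + j ; gap+gap′≡1 = refl
      ; h≤τ = m≤m+n (j + m) j
      ; τ≤2h+1 = m≤n⇒m≤1+n (+-monoʳ-≤ (j + m) (m≤m+n j m))
      ; before = repeated-segment [] W₁ (W₂ ++ W₁ ++ x ∷ W₂) (W₁ ++ W₂) (x ∷ W₂)
                   (++-assoc W₁ W₂ _) refl
                   (trans |W₁W₂| (sym (+-identityʳ _))) (trans |W₁W₂| (sym (+-identityʳ _)))
                   (cong (_+ j) |W₁W₂|)
      ; after = repeated-segment W₁ W₂ (W₁ ++ x ∷ W₂) ((W₁ ++ W₂) ++ W₁ ++ [ x ]) []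
                  (++-assoc W₁ W₂ _)
                  (trans (cong ((W₁ ++ W₂) ++_) (sym (++-assoc W₁ [ x ] W₂)))
                         (++-split-last (W₁ ++ W₂) (W₁ ++ [ x ]) W₂))
                  (trans |X′| (after-offset j m)) (trans |X′| (after-start j m))
                  (trans (cong (_+ m) |X′|) (after-end j m))
      }
    where
    j = length W₁
    m = length W₂
    |W₁W₂| : length (W₁ ++ W₂) ≡ j + m
    |W₁W₂| = length-++ W₁
    |W₁xW₂| : length (W₁ ++ x ∷ W₂) ≡ j + suc m
    |W₁xW₂| = length-++ W₁
    |X′| : length ((W₁ ++ W₂) ++ W₁ ++ [ x ]) ≡ j + m + (j + 1)
    |X′| = trans (length-++ (W₁ ++ W₂)) (cong₂ _+_ |W₁W₂| (length-++ W₁))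
    length≡ : ∀ j m → j + m + (j + suc m) ≡ suc (j + m + (j + m))
    length≡ = solve-∀
    after-offset : ∀ j m → j + m + (j + 1) ≡ j + (j + m + 1)
    after-offset = solve-∀
    after-start : ∀ j m → j + m + (j + 1) ≡ j + m + j + 1
    after-start = solve-∀
    after-end : ∀ j m → j + m + (j + 1) + m ≡ suc (j + m + (j + m))
    after-end = solve-∀

  deletion⇒SplitPeriodic : ∀ (W₁ W₂ : List A) x →
    let u = (W₁ ++ x ∷ W₂) ++ W₁ ++ W₂ ; h = length W₁ + length W₂ in
    length u ≡ suc (h + h) × SplitPeriodic u h
  deletion⇒SplitPeriodic W₁ W₂ x =
    trans (trans (length-++ (W₁ ++ x ∷ W₂)) (cong₂ _+_ |W₁xW₂| |W₁W₂|)) (length≡ j m) , record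
      { gap = 0 ; gap′ = 1 ; τ = j + m + 1 + j ; gap+gap′≡1 = refl
      ; h≤τ = ≤-trans (m≤m+n (j + m) 1) (m≤m+n _ j)
      ; τ≤2h+1 = subst (_≤ suc (j + m + (j + m))) (τ≡ j m) (s≤s (+-monoʳ-≤ (j + m) (m≤m+n j m)))
      ; before = repeated-segment [] W₁ (x ∷ W₂ ++ W₁ ++ W₂) (W₁ ++ x ∷ W₂) W₂
                   (++-assoc W₁ (x ∷ W₂) _) refl
                   (trans |W₁xW₂| (before-offset j m)) (trans |W₁xW₂| (before-offset j m))
                   (trans (cong (_+ j) |W₁xW₂|) (before-end j m))
      ; after = repeated-segment (W₁ ++ [ x ]) W₂ (W₁ ++ W₂) ((W₁ ++ x ∷ W₂) ++ W₁) []
                  (trans (++-assoc W₁ (x ∷ W₂) _) (sym (++-assoc W₁ [ x ] _)))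
                  (++-split-last (W₁ ++ x ∷ W₂) W₁ W₂)
                  (trans (trans |X′| (after-offset j m)) (cong (_+ (j + m + 0)) (sym (length-++ W₁))))
                  (trans |X′| (after-start j m))
                  (trans (cong (_+ m) |X′|) (after-end j m))
      }
    where
    j = length W₁
    m = length W₂
    |W₁W₂| : length (W₁ ++ W₂) ≡ j + m
    |W₁W₂| = length-++ W₁
    |W₁xW₂| : length (W₁ ++ x ∷ W₂) ≡ j + suc m
    |W₁xW₂| = length-++ W₁
    |X′| : length ((W₁ ++ x ∷ W₂) ++ W₁) ≡ j + suc m + j
    |X′| = trans (length-++ (W₁ ++ x ∷ W₂)) (cong (_+ j) |W₁xW₂|)
    length≡ : ∀ j m → j + suc m + (j + m) ≡ suc (j + m + (j + m))
    length≡ = solve-∀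
    τ≡ : ∀ j m → suc (j + m + j) ≡ j + m + 1 + j
    τ≡ = solve-∀
    before-offset : ∀ j m → j + suc m ≡ j + m + 1
    before-offset = solve-∀
    before-end : ∀ j m → j + suc m + j ≡ j + m + 1 + j
    before-end = solve-∀
    after-offset : ∀ j m → j + suc m + j ≡ j + 1 + (j + m + 0)
    after-offset = solve-∀
    after-start : ∀ j m → j + suc m + j ≡ j + m + 1 + j + 0
    after-start = solve-∀
    after-end : ∀ j m → j + suc m + j + m ≡ suc (j + m + (j + m))
    after-end = solve-∀

  almostSquare⇒SplitPeriodic : ∀ {u : List A} → AlmostSquare u →
                               ∃[ h ] length u ≡ suc (h + h) × SplitPeriodic u h
  almostSquare⇒SplitPeriodic (_ , _ , refl , inj₁ (W₁ , W₂ , x , refl , refl)) =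
    _ , extension⇒SplitPeriodic W₁ W₂ x
  almostSquare⇒SplitPeriodic (_ , _ , refl , inj₂ (W₁ , W₂ , x , refl , refl)) =
    _ , deletion⇒SplitPeriodic W₁ W₂ x

  PeriodicOn-take : ∀ {w : List A} {o l h} L → h ≤ L → PeriodicOn (take L w) o l h → PeriodicOn w o l h
  PeriodicOn-take {w} {o} L h≤L per .repeats {p} l≤p+o p+o<h = begin
    w ‼ p               ≡⟨ ‼-take L w (≤-<-trans (m≤m+n p o) p+o<L) ⟨
    take L w ‼ p        ≡⟨ repeats per l≤p+o p+o<h ⟩
    take L w ‼ (p + o)  ≡⟨ ‼-take L w p+o<L ⟩
    w ‼ (p + o)         ∎
    where
    open ≡-Reasoning
    p+o<L = <-≤-trans p+o<h h≤L

  almostSquarePrefix⇒SplitPeriodic : ∀ {w : List A} {L} → L ≤ length w → AlmostSquare (take L w) →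
                                     ∃[ h ] L ≡ suc (h + h) × SplitPeriodic w h
  almostSquarePrefix⇒SplitPeriodic {w} {L} L≤|w| sq with almostSquare⇒SplitPeriodic sq
  ... | h , |u|≡ , sp = h , L≡ , record
    { gap = gap ; gap′ = gap′ ; τ = τ ; gap+gap′≡1 = gap+gap′≡1 ; h≤τ = h≤τ ; τ≤2h+1 = τ≤2h+1
    ; before = PeriodicOn-take L (≤-trans τ≤2h+1 (≤-reflexive (sym L≡))) before
    ; after = PeriodicOn-take L (≤-reflexive (sym L≡)) after
    }
    where
    open SplitPeriodic sp
    L≡ : L ≡ suc (h + h)
    L≡ = trans (sym (length-take-≤ L w L≤|w|)) |u|≡

  module _ {w : List A} (sf : SquareFree w) {c d : ℕ} (0<d : 0 < d)
           (Long : SplitPeriodic w (suc c + d)) (Short : SplitPeriodic w c)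
           (|Long|≤|w| : suc (suc c + d + (suc c + d)) ≤ length w) where

    private
      module Long = SplitPeriodic Long
      module Short = SplitPeriodic Short
      e = suc c + d
      B = suc (c + c)
      lo = e + Long.gap′
      τL = Long.τ
      gL = Long.gap
      τS = Short.τ
      gS = Short.gap

      0<d+ : ∀ x y → 0 < d + x + y
      0<d+ x y = ≤-trans 0<d (≤-trans (m≤m+n d x) (m≤m+n (d + x) y))

      -- Long uses offset e + x and Short offset c + y, with ȳ the other gap value of Short.
      window : ∀ {x y ȳ l h} → y + ȳ ≡ 1 → e + x ≤ l → h ≤ length w →
               PeriodicOn w (e + x) l h → PeriodicOn w (c + y) l h → WindowFree (d + x + ȳ) l h
      window {x} {y} {ȳ} y+ȳ≡1 = PeriodicOn⇒WindowFree sf (0<d+ x ȳ) (begin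
        c + y + (d + x + ȳ)  ≡⟨ regroup c d x y ȳ ⟩
        c + d + x + (y + ȳ)  ≡⟨ cong (c + d + x +_) y+ȳ≡1 ⟩
        c + d + x + 1        ≡⟨ +-comm (c + d + x) 1 ⟩
        e + x                ∎)
        where
        open ≡-Reasoning
        regroup : ∀ c d x y ȳ → c + y + (d + x + ȳ) ≡ c + d + x + (y + ȳ)
        regroup = solve-∀

      short-offset≤lo : c + Short.gap′ ≤ lo
      short-offset≤lo = begin
        c + Short.gap′  ≤⟨ +-monoʳ-≤ c Short.gap′≤1 ⟩
        c + 1           ≡⟨ +-comm c 1 ⟩
        suc c           ≤⟨ m≤m+n (suc c) d ⟩
        e               ≤⟨ m≤m+n e Long.gap′ ⟩
        lo              ∎
        where open ≤-Reasoning

      long-offset≤τ : e + gL ≤ τL + gL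
      long-offset≤τ = +-monoˡ-≤ gL Long.h≤τ

      B≤|Long| : B ≤ suc (e + e)
      B≤|Long| = s≤s (+-mono-≤ c≤e c≤e)
        where c≤e = ≤-trans (n≤1+n c) (m≤m+n (suc c) d)

      B≤|w| : B ≤ length w
      B≤|w| = ≤-trans B≤|Long| |Long|≤|w|

      both-before : τL ≤ τS → WindowFree (d + Long.gap′ + gS) lo (τL ⊓ B)
      both-before τL≤τS = window Short.gap′+gap≡1 ≤-refl (≤-trans (m⊓n≤n τL B) B≤|w|)
        (PeriodicOn-⊆ ≤-refl (m⊓n≤m τL B) Long.before)
        (PeriodicOn-⊆ short-offset≤lo (≤-trans (m⊓n≤m τL B) τL≤τS) Short.before)

      long-switches-first : τL + gL ≤ τS → c ≤ 3 + 4 * d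
      long-switches-first τL+gL≤τS =
        switch-bound₁ Long.gap+gap′≡1 Short.gap+gap′≡1 $
        three-pieces (0<d+ _ _) (0<d+ _ _) (0<d+ _ _)
          (both-before (≤-trans (m≤m+n τL gL) τL+gL≤τS))
          (window Short.gap′+gap≡1 (≤-trans long-offset≤τ (m≤n⊔m lo (τL + gL)))
                  (≤-trans (m⊓n≤n τS B) B≤|w|)
             (PeriodicOn-⊆ (m≤n⊔m lo (τL + gL)) (≤-trans (m⊓n≤n τS B) B≤|Long|) Long.after)
             (PeriodicOn-⊆ (≤-trans short-offset≤lo (m≤m⊔n lo (τL + gL))) (m⊓n≤m τS B) Short.before))
          (window Short.gap+gap′≡1 (≤-trans long-offset≤τ long-after≤) B≤|w|
             (PeriodicOn-⊆ long-after≤ B≤|Long| Long.after)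
             (PeriodicOn-⊆ (m≤n⊔m _ (τS + gS)) ≤-refl Short.after))
        where
        long-after≤ : τL + gL ≤ lo ⊔ (τL + gL) ⊔ (τS + gS)
        long-after≤ = ≤-trans (m≤n⊔m lo (τL + gL)) (m≤m⊔n _ (τS + gS))

      short-switches-first : τS + gS ≤ τL → c ≤ 3 + 4 * d
      short-switches-first τS+gS≤τL =
        switch-bound₂ Long.gap+gap′≡1 Short.gap+gap′≡1 $
        three-pieces (0<d+ _ _) (0<d+ _ _) (0<d+ _ _)
          (window Short.gap′+gap≡1 ≤-refl (≤-trans (m⊓n≤n τS B) B≤|w|)
             (PeriodicOn-⊆ ≤-refl (≤-trans (m⊓n≤m τS B) (≤-trans (m≤m+n τS gS) τS+gS≤τL)) Long.before)
             (PeriodicOn-⊆ short-offset≤lo (m⊓n≤m τS B) Short.before))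
          (window Short.gap+gap′≡1 (m≤m⊔n lo (τS + gS)) (≤-trans (m⊓n≤n τL B) B≤|w|)
             (PeriodicOn-⊆ (m≤m⊔n lo (τS + gS)) (m⊓n≤m τL B) Long.before)
             (PeriodicOn-⊆ (m≤n⊔m lo (τS + gS)) (m⊓n≤n τL B) Short.after))
          (window Short.gap+gap′≡1 (≤-trans long-offset≤τ (m≤n⊔m _ (τL + gL))) B≤|w|
             (PeriodicOn-⊆ (m≤n⊔m _ (τL + gL)) B≤|Long| Long.after)
             (PeriodicOn-⊆ short-after≤ ≤-refl Short.after))
        where
        short-after≤ : τS + gS ≤ lo ⊔ (τS + gS) ⊔ (τL + gL)
        short-after≤ = ≤-trans (m≤n⊔m lo (τS + gS)) (m≤m⊔n _ (τL + gL))

      simultaneous-switch : τL ≤ τS → τS ≤ τL → c ≤ 3 + 4 * d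
      simultaneous-switch τL≤τS τS≤τL =
        switch-bound₃ Long.gap+gap′≡1 Short.gap+gap′≡1 $
        two-pieces (0<d+ _ _) (0<d+ _ _) (both-before τL≤τS) $
        subst (_≤ lo ⊔ (τL + 1) + (d + gL + Short.gap′)) (+-comm 1 B) $
        WindowFree⇒short $
        window Short.gap+gap′≡1 (≤-trans long-offset≤τ long-after≤) B≤|w|
          (PeriodicOn-⊆ long-after≤ B≤|Long| Long.after)
          (PeriodicOn-⊆ (≤-trans (+-mono-≤ τS≤τL Short.gap≤1) (m≤n⊔m lo (τL + 1))) ≤-refl Short.after)
        where
        long-after≤ : τL + gL ≤ lo ⊔ (τL + 1)
        long-after≤ = ≤-trans (+-monoʳ-≤ τL Long.gap≤1) (m≤n⊔m lo (τL + 1))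

    SplitPeriodic-spread : c ≤ 3 + 4 * d
    SplitPeriodic-spread =
      [ long-switches-first , [ short-switches-first , uncurry simultaneous-switch ]′ ]′
        (switch-order τL gL τS gS Long.gap≤1 Short.gap≤1)

  SplitPeriodic-ratio : ∀ {w : List A} {c e} → SquareFree w → suc (e + e) ≤ length w → c + 2 ≤ e →
                        SplitPeriodic w c → SplitPeriodic w e → 5 * c < 4 * e
  SplitPeriodic-ratio {c = c} {e} sf |Long|≤|w| c+2≤e Short Long =
    subst (λ e → 5 * c < 4 * e) suc[c]+d≡e (spread⇒ratio c d spread)
    where
    d = e ∸ suc c
    suc[c]+d≡e : suc c + d ≡ e
    suc[c]+d≡e = m+[n∸m]≡n (≤-trans (n≤1+n (suc c)) (subst (_≤ e) (+-comm c 2) c+2≤e))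
    0<d : 0 < d
    0<d = +-cancelˡ-≤ (suc c) 1 d (subst₂ _≤_ (+-suc c 1) (sym suc[c]+d≡e) c+2≤e)
    spread : c ≤ 3 + 4 * d
    spread = SplitPeriodic-spread sf 0<d (subst (SplitPeriodic _) (sym suc[c]+d≡e) Long) Short
               (subst (λ e → suc (e + e) ≤ _) (sym suc[c]+d≡e) |Long|≤|w|)

  almostSquarePrefixes-ratio : ∀ {w : List A} {L L′} → SquareFree w → L ≤ length w → L′ ≤ length w →
    AlmostSquare (take L w) → AlmostSquare (take L′ w) → L + 4 ≤ L′ → 5 * L < 4 * L′
  almostSquarePrefixes-ratio sf L≤|w| L′≤|w| sq sq′ L+4≤L′
    with almostSquarePrefix⇒SplitPeriodic L≤|w| sq | almostSquarePrefix⇒SplitPeriodic L′≤|w| sq′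
  ... | c , refl , Short | e , refl , Long =
    ratio⇒odd-ratio {c} {e} (SplitPeriodic-ratio sf L′≤|w| c+2≤e Short Long)
    where
    c+2≤e : c + 2 ≤ e
    c+2≤e = m+m≤n+n⇒m≤n (≤-pred (subst (_≤ suc (e + e)) (double-shift c) L+4≤L′))
      where
      double-shift : ∀ c → suc (c + c) + 4 ≡ suc (c + 2 + (c + 2))
      double-shift = solve-∀

Odd : ℕ → Set
Odd x = ∃[ c ] x ≡ suc (c + c)

odd<odd⇒+2≤ : ∀ {x y} → Odd x → Odd y → x < y → x + 2 ≤ y
odd<odd⇒+2≤ (c , refl) (d , refl) x<y =
  subst (_≤ suc (d + d)) (sym (shift c)) (s≤s (+-mono-≤ c<d c<d))
  where
  c<d : c < d
  c<d = ≰⇒> λ d≤c → <⇒≱ x<y (s≤s (+-mono-≤ d≤c d≤c))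
  shift : ∀ c → suc (c + c) + 2 ≡ suc (suc c + suc c)
  shift = solve-∀

Spaced : List ℕ → Set
Spaced = Linked (λ x y → x + 2 ≤ y)

module _ {P : ℕ → Set} (P⇒odd : ∀ {x} → P x → Odd x) where

  open import Data.List.Relation.Unary.All using ([]; _∷_)
  open import Data.List.Relation.Unary.AllPairs using (_∷_)
  open import Data.List.Relation.Unary.Linked using ([]; [-]; _∷_)

  sorted-unique⇒spaced : ∀ {xs} → Linked _≤_ xs → Unique xs → All P xs → Spaced xs
  sorted-unique⇒spaced []             _                   _                = []
  sorted-unique⇒spaced [-]            _                   _                = [-]
  sorted-unique⇒spaced (x≤y ∷ sorted) ((x≢y ∷ _) ∷ unique) (px ∷ py ∷ ps) =
    odd<odd⇒+2≤ (P⇒odd px) (P⇒odd py) (≤∧≢⇒< x≤y x≢y)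
      ∷ sorted-unique⇒spaced sorted unique (py ∷ ps)

  module _ (n : ℕ) (P⇒≤n : ∀ {x} → P x → x ≤ n)
           (P-ratio : ∀ {x y} → P x → P y → x + 4 ≤ y → 5 * x < 4 * y) where

    spaced-product : ∀ {x y zs} → Spaced (x ∷ y ∷ zs) → All P (x ∷ y ∷ zs) →
                     5 ^ length zs * (x * y) ≤ 4 ^ length zs * (n * n)
    spaced-product {zs = []} _ (px ∷ py ∷ []) = *-monoʳ-≤ 1 (*-mono-≤ (P⇒≤n px) (P⇒≤n py))
    spaced-product {x} {y} {z ∷ zs} (x+2≤y ∷ spaced@(y+2≤z ∷ _)) (px ∷ ps@(py ∷ pz ∷ _)) = begin
      5 * 5 ^ r * (x * y)      ≡⟨ regroup₁ (5 ^ r) x y ⟩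
      5 ^ r * (5 * x * y)      ≤⟨ *-monoʳ-≤ (5 ^ r) (*-monoˡ-≤ y (<⇒≤ (P-ratio px pz x+4≤z))) ⟩
      5 ^ r * (4 * z * y)      ≡⟨ regroup₂ (5 ^ r) y z ⟩
      4 * (5 ^ r * (y * z))    ≤⟨ *-monoʳ-≤ 4 (spaced-product spaced ps) ⟩
      4 * (4 ^ r * (n * n))    ≡⟨ *-assoc 4 (4 ^ r) (n * n) ⟨
      4 * 4 ^ r * (n * n)      ∎
      where
      open ≤-Reasoning
      r = length zs
      x+4≤z : x + 4 ≤ z
      x+4≤z = ≤-trans (≤-reflexive (sym (+-assoc x 2 2))) (≤-trans (+-monoˡ-≤ 2 x+2≤y) y+2≤z)
      regroup₁ : ∀ X x y → 5 * X * (x * y) ≡ X * (5 * x * y)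
      regroup₁ = solve-∀
      regroup₂ : ∀ X y z → X * (4 * z * y) ≡ 4 * (X * (y * z))
      regroup₂ = solve-∀

    spaced-count : 2 ≤ n → ∀ {xs} → Spaced xs → All P xs → 5 ^ length xs < 4 ^ length xs * (n * n)
    spaced-count 2≤n [] [] = ≤-trans (s≤s (s≤s z≤n)) (≤-trans 4≤n*n (m≤m+n (n * n) 0))
      where 4≤n*n = *-mono-≤ 2≤n 2≤n
    spaced-count 2≤n [-] _ = ≤-trans (m≤m+n 6 10) (*-monoʳ-≤ 4 (*-mono-≤ 2≤n 2≤n))
    spaced-count 2≤n {x ∷ y ∷ zs} spaced@(x+2≤y ∷ _) ps@(px ∷ _) = begin-strict
      5 * (5 * 5 ^ r)            ≡⟨ *-assoc 5 5 (5 ^ r) ⟨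
      25 * 5 ^ r                 <⟨ *-monoˡ-< (5 ^ r) {{m^n≢0 5 r}} (s≤s (m≤m+n 25 22)) ⟩
      48 * 5 ^ r                 ≡⟨ *-assoc 16 3 (5 ^ r) ⟩
      16 * (3 * 5 ^ r)           ≤⟨ *-monoʳ-≤ 16 3·5^r≤ ⟩
      16 * (4 ^ r * (n * n))     ≡⟨ regroup (4 ^ r) (n * n) ⟩
      4 * (4 * 4 ^ r) * (n * n)  ∎
      where
      open ≤-Reasoning
      r = length zs
      0<x : 0 < x
      0<x with c , refl ← P⇒odd px = s≤s z≤n
      3·5^r≤ : 3 * 5 ^ r ≤ 4 ^ r * (n * n)
      3·5^r≤ = begin
        3 * 5 ^ r        ≡⟨ *-comm 3 (5 ^ r) ⟩
        5 ^ r * 3        ≤⟨ *-monoʳ-≤ (5 ^ r) (*-mono-≤ 0<x (≤-trans (+-monoˡ-≤ 2 0<x) x+2≤y)) ⟩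
        5 ^ r * (x * y)  ≤⟨ spaced-product spaced ps ⟩
        4 ^ r * (n * n)  ∎
      regroup : ∀ X N → 16 * (X * N) ≡ 4 * (4 * X) * N
      regroup = solve-∀

    count-bound : 2 ≤ n → ∀ xs → Unique xs → All P xs → 5 ^ length xs < 4 ^ length xs * n ^ 2
    count-bound 2≤n xs unique ps =
      subst₂ (λ k m → 5 ^ k < 4 ^ k * m) (↭-length (sort-↭ xs)) (cong (n *_) (sym (*-identityʳ n)))
        (spaced-count 2≤n (sorted-unique⇒spaced (sort-↗ xs) sorted-unique sorted-ps) sorted-ps)
      where
      sorted-unique = Unique-resp-↭ (↭⇒↭ₛ (↭-sym (sort-↭ xs))) unique
      sorted-ps = All-resp-↭ (↭-sym (sort-↭ xs)) ps

lemma3p3 : {A : Set} (Q : List A) → 2 ≤ length Q → SquareFree Q →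
    (i : ℕ) → i < length Q →
    (Ls : List ℕ) → Unique Ls →
    All (λ L → (i + L ≤ length Q) × AlmostSquare (factorAt Q i L)) Ls →
    5 ^ length Ls < 4 ^ length Ls * length Q ^ 2
lemma3p3 Q 2≤|Q| sf i _ = count-bound occurs⇒odd (length Q) occurs⇒≤|Q| occurs-ratio 2≤|Q|
  where
  Occurs : ℕ → Set
  Occurs L = (i + L ≤ length Q) × AlmostSquare (factorAt Q i L)
  occurs⇒odd : ∀ {L} → Occurs L → Odd L
  occurs⇒odd (fits , sq) with h , L≡ , _ ← almostSquarePrefix⇒SplitPeriodic (≤-length-drop i Q fits) sq =
    h , L≡
  occurs⇒≤|Q| : ∀ {L} → Occurs L → L ≤ length Q
  occurs⇒≤|Q| {L} (fits , _) = ≤-trans (m≤n+m L i) fits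
  occurs-ratio : ∀ {L L′} → Occurs L → Occurs L′ → L + 4 ≤ L′ → 5 * L < 4 * L′
  occurs-ratio (fits , sq) (fits′ , sq′) = almostSquarePrefixes-ratio (SquareFree-drop i Q sf)
    (≤-length-drop i Q fits) (≤-length-drop i Q fits′) sq sq′
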